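{- Let $\mathbb{G}$ be a finite reflexive digraph such that the identity is alone in its strong component of $Hom(\mathbb{G},\mathbb{G})$. If $f:\mathbb{G}^n \rightarrow \mathbb{G}$ is a surjective, essentially unary polymorphism, then $f$ is alone in its strong component of $Hom(\mathbb{G}^n,\mathbb{G})$.
   Context: All digraphs are finite and reflexive. For digraphs $\mathbb{G},\mathbb{H}$, $Hom(\mathbb{G},\mathbb{H})$ has as vertices the homomorphisms $\mathbb{G}\to\mathbb{H}$, with an arc $(f,g)$ iff $(f(x),g(y))$ is an arc of $\mathbb{H}$ whenever $(x,y)$ is an arc of $\mathbb{G}$. Two vertices $x,y$ of a digraph lie in the same strong component if there are directed walks from $x$ to $y$ and from $y$ to $x$. A polymorphism $f:\mathbb{G}^n\to\mathbb{G}$ is a homomorphism from the product digraph; it is essentially unary if $f(x_1,\dots,x_n)=g(x_i)$ for some $i$ and homomorphism $g:\mathbb{G}\to\mathbb{G}$. -}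

module Defs where

open import Data.Nat using (ℕ)
open import Data.Fin using (Fin)
open import Data.Bool using (Bool; T)
open import Data.Product using (Σ; ∃; _×_; _,_; proj₁)
open import Relation.Binary.PropositionalEquality using (_≡_)
open import Relation.Binary.Construct.Closure.ReflexiveTransitive using (Star)
open import Level using (0ℓ)

record Digraph : Set where
  field
    size : ℕ
    arc  : Fin size → Fin size → Bool

open Digraph public

Arc : (G : Digraph) → Fin (size G) → Fin (size G) → Set
Arc G x y = T (arc G x y)

Reflexive : Digraph → Set
Reflexive G = ∀ x → Arc G x x

-- A general (not necessarily finite-presented) digraph, used for products and Hom-digraphs.
record DG : Set₁ where
  field
    V : Set
    E : V → V → Set

open DG public

toDG : Digraph → DG
toDG G = record { V = Fin (size G) ; E = Arc G }

power : Digraph → ℕ → DG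
power G n = record
  { V = Fin n → Fin (size G)
  ; E = λ x y → ∀ i → Arc G (x i) (y i) }

IsHom : (D : DG) (H : Digraph) → (V D → Fin (size H)) → Set
IsHom D H f = ∀ x y → E D x y → Arc H (f x) (f y)

Homs : (D : DG) (H : Digraph) → Set
Homs D H = Σ (V D → Fin (size H)) (IsHom D H)

HomArc : (D : DG) (H : Digraph) → Homs D H → Homs D H → Set
HomArc D H f g = ∀ x y → E D x y → Arc H (proj₁ f x) (proj₁ g y)

Walk : (D : DG) (H : Digraph) → Homs D H → Homs D H → Set
Walk D H = Star (HomArc D H)

SameStrongComponent : (D : DG) (H : Digraph) → Homs D H → Homs D H → Set
SameStrongComponent D H f g = Walk D H f g × Walk D H g f

SameHom : (D : DG) (H : Digraph) → Homs D H → Homs D H → Set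
SameHom D H f g = ∀ x → proj₁ f x ≡ proj₁ g x

AloneInStrongComponent : (D : DG) (H : Digraph) → Homs D H → Set
AloneInStrongComponent D H f =
  ∀ g → SameStrongComponent D H f g → SameHom D H f g

identityHom : (G : Digraph) → Homs (toDG G) G
identityHom G = (λ x → x) , (λ x y e → e)

Surjective : (D : DG) (H : Digraph) → Homs D H → Set
Surjective D H f = ∀ y → ∃ λ x → proj₁ f x ≡ y

EssentiallyUnary : (G : Digraph) (n : ℕ) → Homs (power G n) G → Set
EssentiallyUnary G n f =
  Σ (Fin n) λ i → Σ (Homs (toDG G) G) λ g →
    ∀ x → proj₁ f x ≡ proj₁ g (x i)

-- Write f = u ∘ πᵢ. Surjectivity of f makes u a permutation of the finite
-- vertex set, so u^(s!) = id and v = u^(s! - 1) is an endomorphism inverse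
-- to u. Fix z ∈ Gⁿ and embed G into Gⁿ by x ↦ z[i ≔ x], a homomorphism
-- because G is reflexive. Then h ↦ v ∘ h ∘ (x ↦ z[i ≔ x]) maps walks of
-- Hom(Gⁿ, G) to walks of Hom(G, G) and sends f to the identity; hence it sends
-- every g in the strong component of f to the identity, and evaluating at z i
-- gives v (g z) = z i, that is g z = u (z i) = f z.
module Submission where

open import Data.Nat using (ℕ; zero; suc; _+_; _*_; _≤_; pred; _!)
open import Data.Nat.Properties
  using (+-comm; +-suc; m≤n+m; ≤-trans; ≤-reflexive; m≤n⇒∃[o]m+o≡n; n<1+n; suc-pred; _!≢0)
open import Data.Nat.Divisibility using (_∣_; divides; ∣-trans; m∣m*n; m≤n⇒m!∣n!)
open import Data.Nat.GeneralisedArithmetic using (fold; fold-+)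
open import Data.Fin using (Fin; toℕ; _≟_)
open import Data.Fin.Properties using (pigeonhole; toℕ≤pred[n])
open import Data.Vec.Functional using (Vector; updateAt)
open import Data.Vec.Functional.Properties using (updateAt-updates; updateAt-minimal)
open import Data.Product using (Σ; ∃; _×_; _,_; proj₁; proj₂)
open import Function using (const; _∘_)
open import Relation.Nullary using (Dec; yes; no; contradiction)
open import Relation.Binary.PropositionalEquality
open import Relation.Binary.Construct.Closure.ReflexiveTransitive using (ε; _◅_; _◅◅_; gmap)
open import Defs

fold-suc-inner : ∀ {A : Set} (x : A) (s : A → A) k → fold x s (suc k) ≡ fold (s x) s k
fold-suc-inner x s k = trans (cong (fold x s) (+-comm 1 k)) (fold-+ x s k)

fold-periodic-∣ : ∀ {A : Set} (u : A → A) {y d m} → fold y u d ≡ y → d ∣ m → fold y u m ≡ y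
fold-periodic-∣ u {y} {d} period (divides q refl) = multiple q
  where
  multiple : ∀ q → fold y u (q * d) ≡ y
  multiple zero    = refl
  multiple (suc q) = trans (fold-+ y u d) (trans (cong (λ w → fold w u d) (multiple q)) period)

module _ {A : Set} (u v : A → A) (u∘v≗id : ∀ y → u (v y) ≡ y) where

  fold-section-cancel : ∀ k y → fold (fold y v k) u k ≡ y
  fold-section-cancel zero    y = refl
  fold-section-cancel (suc k) y = begin
    fold (v (fold y v k)) u (suc k)     ≡⟨ fold-suc-inner _ u k ⟩
    fold (u (v (fold y v k))) u k       ≡⟨ cong (λ w → fold w u k) (u∘v≗id _) ⟩
    fold (fold y v k) u k               ≡⟨ fold-section-cancel k y ⟩
    y                                   ∎
    where open ≡-Reasoning

  fold-section-return : ∀ a d y → fold y v a ≡ fold y v (a + d) → fold y u d ≡ y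
  fold-section-return a d y va≡va+d =
    trans (cong (λ w → fold w u d) y≡vᵈy) (fold-section-cancel d y)
    where
    open ≡-Reasoning
    y≡vᵈy : y ≡ fold y v d
    y≡vᵈy = begin
      y                                   ≡⟨ fold-section-cancel a y ⟨
      fold (fold y v a) u a               ≡⟨ cong (λ w → fold w u a) va≡va+d ⟩
      fold (fold y v (a + d)) u a         ≡⟨ cong (λ w → fold w u a) (fold-+ y v a) ⟩
      fold (fold (fold y v d) v a) u a    ≡⟨ fold-section-cancel a _ ⟩
      fold y v d                          ∎

module _ {s : ℕ} (u v : Fin s → Fin s) (u∘v≗id : ∀ y → u (v y) ≡ y) where

  -- Pigeonhole on the s + 1 points y, v y, …, vˢ y.
  fold-section-returns : ∀ y → ∃ λ e → suc e ≤ s × fold y u (suc e) ≡ y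
  fold-section-returns y with pigeonhole (n<1+n s) (λ k → fold y v (toℕ k))
  ... | a , b , a<b , va≡vb with m≤n⇒∃[o]m+o≡n a<b
  ... | e , a+1+e≡b = e , period≤s , fold-section-return u v u∘v≗id (toℕ a) (suc e) y va≡va+1+e
    where
    b≡a+1+e : toℕ b ≡ toℕ a + suc e
    b≡a+1+e = trans (sym a+1+e≡b) (sym (+-suc (toℕ a) e))
    va≡va+1+e : fold y v (toℕ a) ≡ fold y v (toℕ a + suc e)
    va≡va+1+e = trans va≡vb (cong (fold y v) b≡a+1+e)
    period≤s : suc e ≤ s
    period≤s = ≤-trans (m≤n+m (suc e) (toℕ a))
                 (≤-trans (≤-reflexive (sym b≡a+1+e)) (toℕ≤pred[n] b))

  fold-factorial-section : ∀ y → fold y u (s !) ≡ y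
  fold-factorial-section y with fold-section-returns y
  ... | e , 1+e≤s , period =
    fold-periodic-∣ u {d = suc e} period (∣-trans (m∣m*n (e !)) (m≤n⇒m!∣n! 1+e≤s))

fold-IsHom : (G : Digraph) (u : Homs (toDG G) G) → ∀ k → IsHom (toDG G) G (λ x → fold x (proj₁ u) k)
fold-IsHom G u zero    x y xy = xy
fold-IsHom G u (suc k) x y xy = proj₂ u _ _ (fold-IsHom G u k x y xy)

surjective-endomorphism-inverse : (G : Digraph) (u : Homs (toDG G) G) → Surjective (toDG G) G u →
  Σ (Homs (toDG G) G) λ v → (∀ x → proj₁ v (proj₁ u x) ≡ x) × (∀ y → proj₁ u (proj₁ v y) ≡ y)
surjective-endomorphism-inverse G u surj = v , v∘u≗id , u∘v≗id
  where
  σ : Fin (size G) → Fin (size G)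
  σ = proj₁ u
  q : ℕ
  q = pred (size G !)
  v : Homs (toDG G) G
  v = (λ x → fold x σ q) , fold-IsHom G u q
  u∘v≗id : ∀ y → fold y σ (suc q) ≡ y
  u∘v≗id y = trans (cong (fold y σ) (suc-pred (size G !) {{size G !≢0}}))
                   (fold-factorial-section σ (λ y → proj₁ (surj y)) (λ y → proj₂ (surj y)) y)
  v∘u≗id : ∀ x → fold (σ x) σ q ≡ x
  v∘u≗id x = trans (sym (fold-suc-inner x σ q)) (u∘v≗id x)

SameHom⇒HomArc : ∀ {D H f g} → SameHom D H f g → HomArc D H f g
SameHom⇒HomArc {D} {H} {f} f≈g x y xy = subst (Arc H (proj₁ f x)) (f≈g y) (proj₂ f x y xy)

module _ {D D′ : DG} {H : Digraph}
         (e : V D′ → V D) (e-hom : ∀ x y → E D′ x y → E D (e x) (e y))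
         (w : Homs (toDG H) H) where

  Hom-map : Homs D H → Homs D′ H
  Hom-map (h , h-hom) = (λ x → proj₁ w (h (e x))) , λ x y xy → proj₂ w _ _ (h-hom _ _ (e-hom x y xy))

  Hom-map-Walk : ∀ {h h′} → Walk D H h h′ → Walk D′ H (Hom-map h) (Hom-map h′)
  Hom-map-Walk = gmap Hom-map (λ hh′ x y xy → proj₂ w _ _ (hh′ _ _ (e-hom x y xy)))

  Hom-map-SameStrongComponent : ∀ {k f g} → SameHom D′ H k (Hom-map f) →
    SameStrongComponent D H f g → SameStrongComponent D′ H k (Hom-map g)
  Hom-map-SameStrongComponent {k} {f} k≈f (f⇝g , g⇝f) =
      SameHom⇒HomArc {D′} {H} {k} {Hom-map f} k≈f ◅ Hom-map-Walk f⇝g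
    , Hom-map-Walk g⇝f ◅◅ (SameHom⇒HomArc {D′} {H} {Hom-map f} {k} (λ x → sym (k≈f x)) ◅ ε)

module _ {A : Set} {n : ℕ} (z : Vector A n) (i : Fin n) where

  -- When x already is z i the result is z itself, not merely pointwise equal
  -- to it; without function extensionality this is what lets a function of
  -- the tuple be evaluated back at z.
  replaceAt : (x : A) → Dec (x ≡ z i) → Vector A n
  replaceAt x (yes _) = z
  replaceAt x (no _)  = updateAt z i (const x)

  replaceAt-updates : ∀ x d → replaceAt x d i ≡ x
  replaceAt-updates x (yes x≡zᵢ) = sym x≡zᵢ
  replaceAt-updates x (no _)     = updateAt-updates i z

  replaceAt-minimal : ∀ x d {j} → j ≢ i → replaceAt x d j ≡ z j
  replaceAt-minimal x (yes _) j≢i = refl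
  replaceAt-minimal x (no _)  j≢i = updateAt-minimal _ i z j≢i

  replaceAt-self : ∀ d → replaceAt (z i) d ≡ z
  replaceAt-self (yes _)    = refl
  replaceAt-self (no zᵢ≢zᵢ) = contradiction refl zᵢ≢zᵢ

module _ (G : Digraph) {n : ℕ} (z : Fin n → Fin (size G)) (i : Fin n) where

  lineThrough : Fin (size G) → Fin n → Fin (size G)
  lineThrough x = replaceAt z i x (x ≟ z i)

  lineThrough-at : ∀ x → lineThrough x i ≡ x
  lineThrough-at x = replaceAt-updates z i x (x ≟ z i)

  lineThrough-off : ∀ x {j} → j ≢ i → lineThrough x j ≡ z j
  lineThrough-off x = replaceAt-minimal z i x (x ≟ z i)

  lineThrough-self : lineThrough (z i) ≡ z
  lineThrough-self = replaceAt-self z i (z i ≟ z i)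

  lineThrough-hom : Reflexive G → ∀ x y → Arc G x y → E (power G n) (lineThrough x) (lineThrough y)
  lineThrough-hom reflexive x y xy j with j ≟ i
  ... | yes refl = subst₂ (Arc G) (sym (lineThrough-at x)) (sym (lineThrough-at y)) xy
  ... | no j≢i   = subst₂ (Arc G) (sym (lineThrough-off x j≢i)) (sym (lineThrough-off y j≢i))
                     (reflexive (z j))

unaryPart-surjective : (G : Digraph) {n : ℕ} (f : Homs (power G n) G) (i : Fin n) (u : Homs (toDG G) G) →
  (∀ x → proj₁ f x ≡ proj₁ u (x i)) → Surjective (power G n) G f → Surjective (toDG G) G u
unaryPart-surjective G f i u f≡u∘πᵢ surj y = proj₁ (surj y) i , trans (sym (f≡u∘πᵢ _)) (proj₂ (surj y))

lemma3p4 : (G : Digraph) → Reflexive G →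
           AloneInStrongComponent (toDG G) G (identityHom G) →
           (n : ℕ) (f : Homs (power G n) G) →
           Surjective (power G n) G f → EssentiallyUnary G n f →
           AloneInStrongComponent (power G n) G f
lemma3p4 G reflexive alone n f surj (i , u , f≡u∘πᵢ) g f∼g z = begin
  proj₁ f z                      ≡⟨ f≡u∘πᵢ z ⟩
  σ (z i)                        ≡⟨ cong σ (g↦id (z i)) ⟩
  σ (σ⁻¹ (proj₁ g (line (z i)))) ≡⟨ σ∘σ⁻¹≗id _ ⟩
  proj₁ g (line (z i))           ≡⟨ cong (proj₁ g) (lineThrough-self G z i) ⟩
  proj₁ g z                      ∎
  where
  open ≡-Reasoning
  σ : Fin (size G) → Fin (size G)
  σ = proj₁ u

  inverse : Σ (Homs (toDG G) G) λ v → (∀ x → proj₁ v (σ x) ≡ x) × (∀ y → σ (proj₁ v y) ≡ y)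
  inverse = surjective-endomorphism-inverse G u (unaryPart-surjective G f i u f≡u∘πᵢ surj)

  σ⁻¹ : Fin (size G) → Fin (size G)
  σ⁻¹ = proj₁ (proj₁ inverse)

  σ∘σ⁻¹≗id : ∀ y → σ (σ⁻¹ y) ≡ y
  σ∘σ⁻¹≗id = proj₂ (proj₂ inverse)

  line : Fin (size G) → Fin n → Fin (size G)
  line = lineThrough G z i

  restrict : Homs (power G n) G → Homs (toDG G) G
  restrict = Hom-map line (lineThrough-hom G z i reflexive) (proj₁ inverse)

  f↦id : SameHom (toDG G) G (identityHom G) (restrict f)
  f↦id x = begin
    x                      ≡⟨ proj₁ (proj₂ inverse) x ⟨
    σ⁻¹ (σ x)              ≡⟨ cong (σ⁻¹ ∘ σ) (lineThrough-at G z i x) ⟨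
    σ⁻¹ (σ (line x i))     ≡⟨ cong σ⁻¹ (f≡u∘πᵢ (line x)) ⟨
    σ⁻¹ (proj₁ f (line x)) ∎

  g↦id : SameHom (toDG G) G (identityHom G) (restrict g)
  g↦id = alone (restrict g)
    (Hom-map-SameStrongComponent line (lineThrough-hom G z i reflexive) (proj₁ inverse) f↦id f∼g)
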